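{- Let $F_n(x,y)$ denote the bivariate Fibonacci polynomials. For every integer $n\ge 1$, \[ \frac{\partial F_{n+1}(x,y)}{\partial x}=\sum_{i=0}^{\lfloor \frac{n-1}{2}\rfloor}(-1)^{i}(n-2i)\,F_{n-2i}(x,y)\,y^{i}. \]
   Context: The bivariate Fibonacci polynomials $F_n(x,y)\in\mathbb{Z}[x,y]$, $n\ge 0$, are defined by $F_0(x,y)=0$, $F_1(x,y)=1$ and $F_n(x,y)=xF_{n-1}(x,y)+yF_{n-2}(x,y)$ for $n\ge 2$. -}

module Defs where

open import Data.Nat using (ℕ; zero; suc; _∸_; ⌊_/2⌋)
import Data.Nat as ℕ
open import Data.Integer using (ℤ; +_; -1ℤ; 0ℤ; 1ℤ)
import Data.Integer as ℤ
open import Data.List using (List; upTo; foldr; map)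

-- Bivariate polynomials over ℤ, represented by their coefficient
-- functions: p a b is the coefficient of x^a y^b.
-- (This type is ℤ[[x,y]] ⊇ ℤ[x,y]; all objects built below have
-- finite support, and equality is coefficientwise.)
Poly : Set
Poly = ℕ → ℕ → ℤ

_≈P_ : Poly → Poly → Set
p ≈P q = ∀ a b → p a b ≡ q a b
  where open import Relation.Binary.PropositionalEquality using (_≡_)

infixl 6 _+P_
infixl 7 _·P_

0P : Poly
0P _ _ = 0ℤ

1P : Poly
1P zero zero = 1ℤ
1P _    _    = 0ℤ

_+P_ : Poly → Poly → Poly
(p +P q) a b = p a b ℤ.+ q a b

_·P_ : ℤ → Poly → Poly
(c ·P p) a b = c ℤ.* p a b

x*_ : Poly → Poly
(x* p) zero    b = 0ℤ
(x* p) (suc a) b = p a b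

y*_ : Poly → Poly
(y* p) a zero    = 0ℤ
(y* p) a (suc b) = p a b

y^_*_ : ℕ → Poly → Poly
y^ zero  * p = p
y^ suc i * p = y* (y^ i * p)

∂x : Poly → Poly
∂x p a b = (+ suc a) ℤ.* p (suc a) b

F : ℕ → Poly
F zero          = 0P
F (suc zero)    = 1P
F (suc (suc n)) = (x* F (suc n)) +P (y* F n)

ΣP : List ℕ → (ℕ → Poly) → Poly
ΣP is f = foldr (λ i acc → f i +P acc) 0P is

rhs : ℕ → Poly
rhs n = ΣP (upTo (suc ⌊ n ∸ 1 /2⌋))
           (λ i → ((-1ℤ ℤ.^ i) ℤ.* (+ (n ∸ 2 ℕ.* i))) ·P (y^ i * F (n ∸ 2 ℕ.* i)))

-- Write F′ n = ∂F_n/∂x.  Differentiating F_{n+2} = x F_{n+1} + y F_n gives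
--     F′ (n+2) = F (n+1) + x F′ (n+1) + y F′ n.                    (1)
-- The key identity is
--     F′ (n+2) + y F′ n = (n+1) F_{n+1}                              (2)
-- for every n.  Both sides of (2), as sequences in n, satisfy the same
-- inhomogeneous second-order recurrence (a consequence of (1) on the left,
-- of the Fibonacci recurrence on the right) and they agree for n = 0, 1.
-- Since a second-order recurrence determines a sequence from its first two
-- terms, (2) holds.  By (2), u n = F′ (n+2) satisfies
--     u (n+2) = (n+3) F_{n+3} - y u n,
-- and peeling the first summand off the sum on the right-hand side shows that
-- v n = rhs (n+1) satisfies the same recurrence.  As u and v agree for
-- n = 0, 1, the theorem follows from the same uniqueness principle.

module Submission where

open import Defs
open import Data.Nat using (ℕ; zero; suc; _≤_; _∸_; ⌊_/2⌋)
import Data.Nat as ℕ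
import Data.Nat.Properties as ℕP
open import Data.Integer using (ℤ; +_; -1ℤ; 0ℤ; 1ℤ)
import Data.Integer as ℤ
import Data.Integer.Properties as ℤP
open import Data.Integer.Solver using (module +-*-Solver)
open import Data.List using (List; []; _∷_; upTo)
open import Data.List.Properties using (map-upTo; foldr-map)
open import Data.Product using (_×_; _,_; proj₁)
open import Relation.Binary.Bundles using (Setoid)
open import Relation.Binary.PropositionalEquality
  using (_≡_; refl; sym; trans; cong; cong₂)

open +-*-Solver using (solve; _:+_; _:*_; _:=_; con)

≈P-refl : ∀ {p} → p ≈P p
≈P-refl _ _ = refl

≈P-sym : ∀ {p q} → p ≈P q → q ≈P p
≈P-sym e a b = sym (e a b)

≈P-trans : ∀ {p q r} → p ≈P q → q ≈P r → p ≈P r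
≈P-trans e f a b = trans (e a b) (f a b)

Poly-setoid : Setoid _ _
Poly-setoid = record
  { Carrier       = Poly
  ; _≈_           = _≈P_
  ; isEquivalence = record { refl = ≈P-refl ; sym = ≈P-sym ; trans = ≈P-trans }
  }

open import Relation.Binary.Reasoning.Setoid Poly-setoid

+P-cong : ∀ {p p′ q q′} → p ≈P p′ → q ≈P q′ → (p +P q) ≈P (p′ +P q′)
+P-cong e f a b = cong₂ ℤ._+_ (e a b) (f a b)

·P-cong : ∀ c {p q} → p ≈P q → (c ·P p) ≈P (c ·P q)
·P-cong c e a b = cong (c ℤ.*_) (e a b)

+P-identityʳ : ∀ {p q} → q ≈P 0P → (p +P q) ≈P p
+P-identityʳ {p} e a b = trans (cong (ℤ._+_ (p a b)) (e a b)) (ℤP.+-identityʳ (p a b))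

x*-cong : ∀ {p q} → p ≈P q → (x* p) ≈P (x* q)
x*-cong e zero    b = refl
x*-cong e (suc a) b = e a b

x*-+ : ∀ p q → (x* (p +P q)) ≈P ((x* p) +P (x* q))
x*-+ p q zero    b = refl
x*-+ p q (suc a) b = refl

x*-· : ∀ c p → (x* (c ·P p)) ≈P (c ·P (x* p))
x*-· c p zero    b = sym (ℤP.*-zeroʳ c)
x*-· c p (suc a) b = refl

x*-0 : ∀ {p} → p ≈P 0P → (x* p) ≈P 0P
x*-0 e zero    b = refl
x*-0 e (suc a) b = e a b

y*-cong : ∀ {p q} → p ≈P q → (y* p) ≈P (y* q)
y*-cong e a zero    = refl
y*-cong e a (suc b) = e a b

y*-+ : ∀ p q → (y* (p +P q)) ≈P ((y* p) +P (y* q))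
y*-+ p q a zero    = refl
y*-+ p q a (suc b) = refl

y*-· : ∀ c p → (y* (c ·P p)) ≈P (c ·P (y* p))
y*-· c p a zero    = sym (ℤP.*-zeroʳ c)
y*-· c p a (suc b) = refl

y*-0 : ∀ {p} → p ≈P 0P → (y* p) ≈P 0P
y*-0 e a zero    = refl
y*-0 e a (suc b) = e a b

x*y*-comm : ∀ p → (x* (y* p)) ≈P (y* (x* p))
x*y*-comm p zero    zero    = refl
x*y*-comm p zero    (suc b) = refl
x*y*-comm p (suc a) zero    = refl
x*y*-comm p (suc a) (suc b) = refl

∂x-+ : ∀ p q → ∂x (p +P q) ≈P (∂x p +P ∂x q)
∂x-+ p q a b = ℤP.*-distribˡ-+ (+ suc a) (p (suc a) b) (q (suc a) b)

∂x-y* : ∀ p → ∂x (y* p) ≈P (y* (∂x p))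
∂x-y* p a zero    = ℤP.*-zeroʳ (+ suc a)
∂x-y* p a (suc b) = refl

∂x-x* : ∀ p → ∂x (x* p) ≈P (p +P (x* (∂x p)))
∂x-x* p zero    b = trans (ℤP.*-identityˡ (p zero b)) (sym (ℤP.+-identityʳ (p zero b)))
∂x-x* p (suc a) b = trans (ℤP.*-distribʳ-+ (p (suc a) b) 1ℤ (+ suc a))
                           (cong (ℤ._+ (+ suc a ℤ.* p (suc a) b)) (ℤP.*-identityˡ (p (suc a) b)))

∂x-constant : ∀ p → (∀ a b → p (suc a) b ≡ 0ℤ) → ∂x p ≈P 0P
∂x-constant p e a b = trans (cong ((+ suc a) ℤ.*_) (e a b)) (ℤP.*-zeroʳ (+ suc a))

Step : Set
Step = ℕ → Poly → Poly → Poly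

Congruent : Step → Set
Congruent Φ = ∀ n {p p′ q q′} → p ≈P p′ → q ≈P q′ → Φ n p q ≈P Φ n p′ q′

Solves : Step → (ℕ → Poly) → Set
Solves Φ u = ∀ n → u (suc (suc n)) ≈P Φ n (u (suc n)) (u n)

recurrence-unique : ∀ {Φ u v} → Congruent Φ → Solves Φ u → Solves Φ v →
                    u 0 ≈P v 0 → u 1 ≈P v 1 → ∀ n → u n ≈P v n
recurrence-unique {u = u} {v = v} Φ-cong solves-u solves-v e₀ e₁ n = proj₁ (agree n)
  where
  agree : ∀ n → u n ≈P v n × u (suc n) ≈P v (suc n)
  agree zero    = e₀ , e₁
  agree (suc n) with agree n
  ... | eₙ , eₙ₊₁ = eₙ₊₁ , ≈P-trans (solves-u n) (≈P-trans (Φ-cong n eₙ₊₁ eₙ) (≈P-sym (solves-v n)))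

ΣP-upTo-suc : ∀ k f → ΣP (upTo (suc k)) f ≡ f 0 +P ΣP (upTo k) (λ i → f (suc i))
ΣP-upTo-suc k f = cong (f 0 +P_)
  (trans (cong (λ is → ΣP is f) (sym (map-upTo suc k)))
         (foldr-map (λ i acc → f i +P acc) suc 0P (upTo k)))

ΣP-cong : ∀ is {f g} → (∀ i → f i ≈P g i) → ΣP is f ≈P ΣP is g
ΣP-cong []       e = ≈P-refl
ΣP-cong (i ∷ is) e = +P-cong (e i) (ΣP-cong is e)

ΣP-linear : ∀ (L : Poly → Poly) → (∀ p q → L (p +P q) ≈P (L p +P L q)) → L 0P ≈P 0P →
            ∀ is f → ΣP is (λ i → L (f i)) ≈P L (ΣP is f)
ΣP-linear L L-+ L-0 []       f = ≈P-sym L-0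
ΣP-linear L L-+ L-0 (i ∷ is) f = begin
  L (f i) +P ΣP is (λ j → L (f j))  ≈⟨ +P-cong (≈P-refl {L (f i)}) (ΣP-linear L L-+ L-0 is f) ⟩
  L (f i) +P L (ΣP is f)             ≈⟨ ≈P-sym (L-+ (f i) (ΣP is f)) ⟩
  L (f i +P ΣP is f)                 ∎

ΣP-upTo-1 : ∀ f → ΣP (upTo 1) f ≈P f 0
ΣP-upTo-1 f = +P-identityʳ (≈P-refl {0P})

·P-distrib : ∀ c p q → (c ·P (p +P q)) ≈P ((c ·P p) +P (c ·P q))
·P-distrib c p q a b = ℤP.*-distribˡ-+ c (p a b) (q a b)

·P-identity : ∀ p → ((+ 1) ·P p) ≈P p
·P-identity p a b = ℤP.*-identityˡ (p a b)

·P-zero : ∀ c → (c ·P 0P) ≈P 0P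
·P-zero c a b = ℤP.*-zeroʳ c

isolate : ∀ {p q r} → (p +P q) ≈P r → p ≈P (r +P (-1ℤ ·P q))
isolate {p} {q} e a b = trans
  (solve 2 (λ u v → u := (u :+ v) :+ con -1ℤ :* v) refl (p a b) (q a b))
  (cong (ℤ._+ (-1ℤ ℤ.* q a b)) (e a b))

+P-interchange : ∀ p q r s t w →
  (((p +P q) +P r) +P ((s +P t) +P w)) ≈P (((p +P s) +P (q +P t)) +P (r +P w))
+P-interchange p q r s t w a b =
  solve 6 (λ p q r s t w → ((p :+ q) :+ r) :+ ((s :+ t) :+ w)
                         := ((p :+ s) :+ (q :+ t)) :+ (r :+ w))
        refl (p a b) (q a b) (r a b) (s a b) (t a b) (w a b)

F′ : ℕ → Poly
F′ n = ∂x (F n)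

F′-rec : ∀ n → F′ (suc (suc n)) ≈P ((F (suc n) +P (x* F′ (suc n))) +P (y* F′ n))
F′-rec n = begin
  ∂x ((x* F (suc n)) +P (y* F n))      ≈⟨ ∂x-+ (x* F (suc n)) (y* F n) ⟩
  ∂x (x* F (suc n)) +P ∂x (y* F n)    ≈⟨ +P-cong (∂x-x* (F (suc n))) (∂x-y* (F n)) ⟩
  (F (suc n) +P (x* F′ (suc n))) +P (y* F′ n) ∎

F′-0 : F′ 0 ≈P 0P
F′-0 = ∂x-constant (F 0) (λ _ _ → refl)

F′-1 : F′ 1 ≈P 0P
F′-1 = ∂x-constant (F 1) (λ _ _ → refl)

F′-2 : F′ 2 ≈P F 1
F′-2 = begin
  F′ 2                              ≈⟨ F′-rec 0 ⟩
  (F 1 +P (x* F′ 1)) +P (y* F′ 0)  ≈⟨ +P-identityʳ (y*-0 F′-0) ⟩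
  F 1 +P (x* F′ 1)                 ≈⟨ +P-identityʳ (x*-0 F′-1) ⟩
  F 1                               ∎

F′-3 : F′ 3 ≈P ((+ 2) ·P F 2)
F′-3 = begin
  F′ 3                              ≈⟨ F′-rec 1 ⟩
  (F 2 +P (x* F′ 2)) +P (y* F′ 1)  ≈⟨ +P-identityʳ (y*-0 F′-1) ⟩
  F 2 +P (x* F′ 2)                 ≈⟨ +P-cong (≈P-refl {F 2}) (x*-cong F′-2) ⟩
  F 2 +P (x* F 1)                  ≈⟨ +P-cong (≈P-refl {F 2}) (≈P-sym F-2) ⟩
  F 2 +P F 2                       ≈⟨ (λ a b → solve 1 (λ u → u :+ u := con (+ 2) :* u) refl (F 2 a b)) ⟩
  (+ 2) ·P F 2                      ∎
  where
  F-2 : F 2 ≈P (x* F 1)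
  F-2 = +P-identityʳ (y*-0 (≈P-refl {F 0}))

key-step : Step
key-step n p q = ((F (3 ℕ.+ n) +P (y* F (1 ℕ.+ n))) +P (x* p)) +P (y* q)

key-step-cong : Congruent key-step
key-step-cong n e f =
  +P-cong (+P-cong (≈P-refl {F (3 ℕ.+ n) +P (y* F (1 ℕ.+ n))}) (x*-cong e)) (y*-cong f)

key-lhs : ℕ → Poly
key-lhs n = F′ (suc (suc n)) +P (y* F′ n)

key-rhs : ℕ → Poly
key-rhs n = (+ suc n) ·P F (suc n)

key-lhs-solves : Solves key-step key-lhs
key-lhs-solves n = begin
  F′ (4 ℕ.+ n) +P (y* D₂)
    ≈⟨ +P-cong (F′-rec (2 ℕ.+ n)) (y*-cong (F′-rec n)) ⟩
  ((F₃ +P (x* D₃)) +P (y* D₂)) +P (y* ((F₁ +P (x* D₁)) +P (y* D₀)))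
    ≈⟨ +P-cong (≈P-refl {(F₃ +P (x* D₃)) +P (y* D₂)}) y-inside ⟩
  ((F₃ +P (x* D₃)) +P (y* D₂)) +P (((y* F₁) +P (x* (y* D₁))) +P (y* (y* D₀)))
    ≈⟨ +P-interchange F₃ (x* D₃) (y* D₂) (y* F₁) (x* (y* D₁)) (y* (y* D₀)) ⟩
  ((F₃ +P (y* F₁)) +P ((x* D₃) +P (x* (y* D₁)))) +P ((y* D₂) +P (y* (y* D₀)))
    ≈⟨ +P-cong (+P-cong (≈P-refl {F₃ +P (y* F₁)}) (≈P-sym (x*-+ D₃ (y* D₁))))
               (≈P-sym (y*-+ D₂ (y* D₀))) ⟩
  key-step n (key-lhs (suc n)) (key-lhs n) ∎
  where
  F₁ F₃ D₀ D₁ D₂ D₃ : Poly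
  F₁ = F (1 ℕ.+ n)
  F₃ = F (3 ℕ.+ n)
  D₀ = F′ n
  D₁ = F′ (1 ℕ.+ n)
  D₂ = F′ (2 ℕ.+ n)
  D₃ = F′ (3 ℕ.+ n)

  y-inside : (y* ((F₁ +P (x* D₁)) +P (y* D₀))) ≈P (((y* F₁) +P (x* (y* D₁))) +P (y* (y* D₀)))
  y-inside = begin
    y* ((F₁ +P (x* D₁)) +P (y* D₀))             ≈⟨ y*-+ (F₁ +P (x* D₁)) (y* D₀) ⟩
    (y* (F₁ +P (x* D₁))) +P (y* (y* D₀))        ≈⟨ +P-cong (y*-+ F₁ (x* D₁)) (≈P-refl {y* (y* D₀)}) ⟩
    ((y* F₁) +P (y* (x* D₁))) +P (y* (y* D₀))   ≈⟨ +P-cong (+P-cong (≈P-refl {y* F₁}) (≈P-sym (x*y*-comm D₁)))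
                                                            (≈P-refl {y* (y* D₀)}) ⟩
    ((y* F₁) +P (x* (y* D₁))) +P (y* (y* D₀))   ∎

key-rhs-solves : Solves key-step key-rhs
key-rhs-solves n = begin
  (+ (3 ℕ.+ n)) ·P F (3 ℕ.+ n)
    ≈⟨ (λ a b → solve 3 (λ m X Y → (con 1ℤ :+ (con 1ℤ :+ m)) :* (X :+ Y)
                                := ((X :+ Y) :+ Y) :+ (con 1ℤ :+ m) :* X :+ m :* Y)
                      refl (+ suc n) ((x* F (2 ℕ.+ n)) a b) ((y* F (1 ℕ.+ n)) a b)) ⟩
  ((F (3 ℕ.+ n) +P (y* F (1 ℕ.+ n))) +P ((+ (2 ℕ.+ n)) ·P (x* F (2 ℕ.+ n))))
    +P ((+ (1 ℕ.+ n)) ·P (y* F (1 ℕ.+ n)))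
    ≈⟨ +P-cong (+P-cong (≈P-refl {F (3 ℕ.+ n) +P (y* F (1 ℕ.+ n))})
                        (≈P-sym (x*-· (+ (2 ℕ.+ n)) (F (2 ℕ.+ n)))))
               (≈P-sym (y*-· (+ (1 ℕ.+ n)) (F (1 ℕ.+ n)))) ⟩
  key-step n (key-rhs (suc n)) (key-rhs n) ∎

key-identity : ∀ n → (F′ (suc (suc n)) +P (y* F′ n)) ≈P ((+ suc n) ·P F (suc n))
key-identity = recurrence-unique {u = key-lhs} {v = key-rhs}
  key-step-cong key-lhs-solves key-rhs-solves
  (≈P-trans (+P-identityʳ (y*-0 F′-0)) (≈P-trans F′-2 (≈P-sym (·P-identity (F 1)))))
  (≈P-trans (+P-identityʳ (y*-0 F′-1)) F′-3)

term : ℕ → ℕ → Poly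
term n i = ((-1ℤ ℤ.^ i) ℤ.* (+ (n ∸ 2 ℕ.* i))) ·P (y^ i * F (n ∸ 2 ℕ.* i))

term-leading : ∀ n → term n 0 ≈P ((+ n) ·P F n)
term-leading n a b = cong (ℤ._* F n a b) (ℤP.*-identityˡ (+ n))

rhs-1 : rhs 1 ≈P F 1
rhs-1 = ≈P-trans (ΣP-upTo-1 (term 1)) (≈P-trans (term-leading 1) (·P-identity (F 1)))

rhs-2 : rhs 2 ≈P ((+ 2) ·P F 2)
rhs-2 = ≈P-trans (ΣP-upTo-1 (term 2)) (term-leading 2)

index-shift : ∀ m i → suc (suc m) ∸ 2 ℕ.* suc i ≡ m ∸ 2 ℕ.* i
index-shift m i = cong (suc (suc m) ∸_) (ℕP.*-suc 2 i)

term-shift : ∀ m i → term (suc (suc m)) (suc i) ≈P (-1ℤ ·P (y* term m i))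
term-shift m i rewrite index-shift m i = begin
  ((-1ℤ ℤ.* s) ℤ.* k) ·P (y* P)    ≈⟨ (λ a b → solve 3 (λ s k p → (con -1ℤ :* s :* k) :* p
                                                            := con -1ℤ :* (s :* k :* p))
                                                       refl s k ((y* P) a b)) ⟩
  -1ℤ ·P ((s ℤ.* k) ·P (y* P))     ≈⟨ ·P-cong -1ℤ (≈P-sym (y*-· (s ℤ.* k) P)) ⟩
  -1ℤ ·P (y* ((s ℤ.* k) ·P P))     ∎
  where
  s k : ℤ
  s = -1ℤ ℤ.^ i
  k = + (m ∸ 2 ℕ.* i)
  P : Poly
  P = y^ i * F (m ∸ 2 ℕ.* i)

-- The recurrence satisfied by both sides of the theorem, shifted so that it
-- holds from the start:  w (n+2) = (n+3) F_{n+3} - y w n.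

main-step : Step
main-step n p q = ((+ (3 ℕ.+ n)) ·P F (3 ℕ.+ n)) +P (-1ℤ ·P (y* q))

main-step-cong : Congruent main-step
main-step-cong n e f = +P-cong (≈P-refl {(+ (3 ℕ.+ n)) ·P F (3 ℕ.+ n)}) (·P-cong -1ℤ (y*-cong f))

F′-solves : Solves main-step (λ n → F′ (suc (suc n)))
F′-solves n = isolate (key-identity (suc (suc n)))

rhs-solves : Solves main-step (λ n → rhs (suc n))
rhs-solves n = begin
  rhs (3 ℕ.+ n)
    ≡⟨ ΣP-upTo-suc (suc ⌊ n /2⌋) (term (3 ℕ.+ n)) ⟩
  term (3 ℕ.+ n) 0 +P ΣP is (λ i → term (3 ℕ.+ n) (suc i))
    ≈⟨ +P-cong (term-leading (3 ℕ.+ n)) (ΣP-cong is (term-shift (suc n))) ⟩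
  ((+ (3 ℕ.+ n)) ·P F (3 ℕ.+ n)) +P ΣP is (λ i → -1ℤ ·P (y* term (1 ℕ.+ n) i))
    ≈⟨ +P-cong (≈P-refl {(+ (3 ℕ.+ n)) ·P F (3 ℕ.+ n)}) sum-out ⟩
  main-step n (rhs (2 ℕ.+ n)) (rhs (1 ℕ.+ n)) ∎
  where
  is : List ℕ
  is = upTo (suc ⌊ n /2⌋)

  sum-out : ΣP is (λ i → -1ℤ ·P (y* term (1 ℕ.+ n) i)) ≈P (-1ℤ ·P (y* rhs (1 ℕ.+ n)))
  sum-out = ≈P-trans
    (ΣP-linear (-1ℤ ·P_) (·P-distrib -1ℤ) (·P-zero -1ℤ) is (λ i → y* term (1 ℕ.+ n) i))
    (·P-cong -1ℤ (ΣP-linear y*_ y*-+ (y*-0 (≈P-refl {0P})) is (term (1 ℕ.+ n))))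

mainTheorem2 : (n : ℕ) → 1 ≤ n → ∂x (F (suc n)) ≈P rhs n
mainTheorem2 zero    ()
mainTheorem2 (suc n) _ = recurrence-unique {u = λ m → F′ (suc (suc m))} {v = λ m → rhs (suc m)}
  main-step-cong F′-solves rhs-solves
  (≈P-trans F′-2 (≈P-sym rhs-1))
  (≈P-trans F′-3 (≈P-sym rhs-2))
  n
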